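{- Let $k\ge 4$ and let $W_k$, $S$, $T$ be as defined in the context. There exists an integer $f(k)$ with $k-2\le f(k)\le k+3$ such that $(W_k,S,T,3k^2+f(k),6k^2)$ is a yes-instance and $(W_k,S,T,3k^2+f(k)-1,6k^2)$ is a no-instance of Vertex Cover Reconfiguration.
   Context: An instance $(G,S,T,k',\ell)$ of Vertex Cover Reconfiguration consists of a graph $G$, positive integers $k',\ell$, and vertex covers $S,T$ of $G$ of size at most $k'$; it is a yes-instance iff $S$ can be transformed into $T$ by at most $\ell$ steps, each adding or removing a single vertex, such that after every step the current set is a vertex cover of $G$ of size at most $k'$. For $k\ge4$, a $k$-necklace is obtained from a cycle on $k$ vertices (called beads) by replacing each edge $\{x,y\}$ of the cycle with two new vertices (sequins), each adjacent to exactly $x$ and $y$ (the edge $\{x,y\}$ itself is deleted); the two sequins replacing one edge form a sequin pair. The graph $W_k$ consists of $2k$ disjoint $k$-necklaces $U_1,\dots,U_k$ (upper) and $L_1,\dots,L_k$ (lower). In each necklace $N\in\{U_i,L_i\}$ the beads are $b^x_{i,1},\dots,b^x_{i,k}$ ($x=u$ for $U_i$, $x=l$ for $L_i$) in cyclic order, and $p^x_{i,j}$ denotes the sequin pair linking $b^x_{i,j}$ and $b^x_{i,j+1}$ (indices mod $k$, so $p^x_{i,k}$ links $b^x_{i,k}$ and $b^x_{i,1}$). Additionally, for all $1\le i,j\le k$, all four edges between the sequin pair $p^l_{i,j}$ and the sequin pair $p^u_{j,i}$ are added. Thus $W_k$ is $4$-regular with $6k^2$ vertices. Let $S$ be the set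 of all upper beads together with all lower sequins, and $T$ the set of all lower beads together with all upper sequins; $|S|=|T|=3k^2$. -}

module Defs where

open import Data.Nat using (ℕ; zero; suc; _+_; _*_; _≤_)
open import Data.Fin using (Fin; toℕ)
open import Data.Fin.Base using () renaming (zero to fzero)
open import Data.Bool using (Bool; true; false; T)
open import Data.List using (List; length; filter; allFin; concatMap; map; [])
open import Data.List.Base using (_∷_)
open import Data.List.Membership.Propositional using (_∈_)
open import Data.List.Relation.Unary.Unique.Propositional using (Unique)
open import Data.Product using (Σ; _×_; _,_; ∃)
open import Data.Sum using (_⊎_)
open import Relation.Nullary using (¬_)
open import Relation.Binary.PropositionalEquality using (_≡_; _≢_)
import Data.Bool.Properties as BP
open import Relation.Nullary.Decidable using (Dec)

record FinGraph : Set₁ where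
  field
    V        : Set
    Adj      : V → V → Set       -- edge relation (symmetric by construction)
    vertices : List V            -- enumeration of all vertices, each once
open FinGraph public

VSet : FinGraph → Set
VSet G = V G → Bool

_∋ˢ_ : ∀ {A : Set} → (A → Bool) → A → Set
X ∋ˢ v = T (X v)

size : (G : FinGraph) → VSet G → ℕ
size G X = length (filter (λ v → T? (X v)) (vertices G))
  where
  T? : (b : Bool) → Dec (T b)
  T? = BP.T?

IsVertexCover : (G : FinGraph) → VSet G → Set
IsVertexCover G X = ∀ u v → Adj G u v → (X ∋ˢ u) ⊎ (X ∋ˢ v)

OneStep : (G : FinGraph) → VSet G → VSet G → Set
OneStep G X Y = Σ (V G) λ v → (X v ≢ Y v) × (∀ w → w ≢ v → X w ≡ Y w)

-- X can be transformed into Y in at most ℓ steps, every intermediate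
-- (and final) set being a vertex cover of size at most k'
data Reconf (G : FinGraph) (k' : ℕ) : ℕ → VSet G → VSet G → Set where
  done : ∀ {ℓ X Y} → (∀ v → X v ≡ Y v) → Reconf G k' ℓ X Y
  step : ∀ {ℓ X Y Z} → OneStep G X Y → IsVertexCover G Y → size G Y ≤ k' →
         Reconf G k' ℓ Y Z → Reconf G k' (suc ℓ) X Z

ValidInstance : (G : FinGraph) → VSet G → VSet G → ℕ → Set
ValidInstance G S T' k' =
  IsVertexCover G S × size G S ≤ k' × IsVertexCover G T' × size G T' ≤ k'

YesInstance : (G : FinGraph) → VSet G → VSet G → ℕ → ℕ → Set
YesInstance G S T' k' ℓ = ValidInstance G S T' k' × Reconf G k' ℓ S T'

NoInstance : (G : FinGraph) → VSet G → VSet G → ℕ → ℕ → Set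
NoInstance G S T' k' ℓ = ValidInstance G S T' k' × ¬ Reconf G k' ℓ S T'

data Side : Set where
  up low : Side

-- a vertex of a necklace at position j: the bead b_j, or one of the two
-- sequins of the pair p_j (linking b_j and b_{j+1})
data Part : Set where
  bead   : Part
  sequin : Fin 2 → Part

-- vertex (x , i , j , part): in necklace U_i (x = up) or L_i (x = low),
-- the bead b^x_{i,j} or a sequin of the pair p^x_{i,j}
record WV (k : ℕ) : Set where
  constructor wv
  field
    side : Side
    neck : Fin k
    pos  : Fin k
    part : Part

CycSucc : ∀ {k} → Fin k → Fin k → Set
CycSucc {k} j j' = (toℕ j' ≡ suc (toℕ j)) ⊎ ((toℕ j' ≡ 0) × (suc (toℕ j) ≡ k))

data WE {k : ℕ} : WV k → WV k → Set where
  seq-left  : ∀ x i j s → WE (wv x i j (sequin s)) (wv x i j bead)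
  seq-right : ∀ x i j j' s → CycSucc j j' → WE (wv x i j (sequin s)) (wv x i j' bead)
  cross     : ∀ i j s t → WE (wv low i j (sequin s)) (wv up j i (sequin t))

WAdj : ∀ {k} → WV k → WV k → Set
WAdj u v = WE u v ⊎ WE v u

allSides : List Side
allSides = up ∷ low ∷ []

allParts : List Part
allParts = bead ∷ sequin fzero ∷ sequin (Data.Fin.suc fzero) ∷ []

allWV : (k : ℕ) → List (WV k)
allWV k = concatMap (λ x → concatMap (λ i → concatMap (λ j →
            map (λ p → wv x i j p) allParts) (allFin k)) (allFin k)) allSides

-- W_k as a finite graph (allWV k lists each of the 6k² vertices exactly once)
W : (k : ℕ) → FinGraph
W k = record { V = WV k ; Adj = WAdj ; vertices = allWV k }

Sset : ∀ {k} → WV k → Bool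
Sset (wv up _ _ bead)       = true
Sset (wv up _ _ (sequin _)) = false
Sset (wv low _ _ bead)       = false
Sset (wv low _ _ (sequin _)) = true

Tset : ∀ {k} → WV k → Bool
Tset (wv up _ _ bead)       = false
Tset (wv up _ _ (sequin _)) = true
Tset (wv low _ _ bead)       = true
Tset (wv low _ _ (sequin _)) = false

-- Cell (i , j) of W_k consists of position j of U_i and position i of L_j, a bead and a
-- sequin pair each. It contains three disjoint edges, so a vertex cover has at least three
-- vertices in each of the k² cells, with equality for S and T.
--
-- In S every upper sequin pair is incomplete, in T every one is complete. Take
-- the first cover of a reconfiguration sequence in which no upper necklace has all its pairs
-- incomplete; one step earlier some U_r had, so U_r is still incomplete except at one
-- position. If every upper necklace has pairs of both kinds, each has an incomplete pair
-- followed by a complete one, and the bead between them is a fourth vertex in one cell of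
-- every row. Otherwise some U_z is complete, and in every column but one either cell (z , j)
-- has both pairs complete, or the lower pairs pass from incomplete (row z) to complete (row r,
-- forced by the cross edges) and a lower bead again adds a fourth vertex. Either way the cover
-- has at least 3k² + k - 1 vertices.
--
-- Switch every vertex exactly once, in the lexicographic order of a position
-- (row, column, slot) chosen so that on every edge the vertex of T is added before the vertex
-- of S is removed. At any time only two consecutive rows of cells are out of balance, and in
-- column j they carry at most 1 + [j = 0] + 2 [j = current column] extra vertices, so no
-- intermediate cover exceeds 3k² + k + 3.
--
-- Reconfigurability is decidable by exhaustive search, so the least feasible budget 3k² + f
-- can be located between these bounds.

module Submission where

open import Defs
open import Data.Bool using (Bool; true; false; T; not; if_then_else_) renaming (_≟_ to _≟ᵇ_)
open import Data.Empty using (⊥-elim)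
open import Data.Fin using (Fin; zero; suc; toℕ; inject₁)
open import Data.Fin.Induction using (<-weakInduction; <-weakInduction-startingFrom)
import Data.Fin.Properties as Fin
open import Data.List using (List; []; _∷_; _++_; length; filter; map; concatMap; allFin; tabulate)
open import Data.List.Membership.Propositional using (_∈_; lose)
open import Data.List.Membership.Propositional.Properties using (∈-map⁺; ∈-concat⁺′; ∈-allFin)
open import Data.List.Properties using (filter-++; length-++)
open import Data.List.Relation.Unary.Any using (here; there; any?; satisfied)
open import Data.Nat using (ℕ; zero; suc; pred; _+_; _*_; _∸_; _≤_; _<_; _<ᵇ_; _≤?_; _≟_; z≤n; s≤s; s≤s⁻¹)
open import Data.Nat.DivMod using (_/_; _%_; _mod_; m≡m%n+[m/n]*n; m%n<n; m<n⇒m%n≡m; n%n≡0)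
open import Data.Nat.Properties
open import Data.Nat.Tactic.RingSolver using (solve-∀)
open import Algebra.Properties.CommutativeMonoid.Sum +-0-commutativeMonoid
  using (sum-syntax; sum-cong-≗; ∑-distrib-+; ∑-comm)
open import Data.Product using (Σ; ∃; _×_; _,_; proj₁; proj₂)
open import Data.Sum using (_⊎_; inj₁; inj₂; swap)
open import Function using (_∘_; id)
open import Relation.Binary using (DecidableEquality)
open import Relation.Binary.PropositionalEquality
open import Relation.Nullary using (¬_; Dec; yes; no; does; ¬?)
open import Relation.Nullary.Decidable
  using (True; toWitness; T?; map′; _⊎-dec_; _×-dec_; _→-dec_; decidable-stable)
import Relation.Unary as U

-- Sums and comparisons of natural numbers

𝟙 : Bool → ℕ
𝟙 true  = 1
𝟙 false = 0

𝟙-mono : ∀ {a b} → (T a → T b) → 𝟙 a ≤ 𝟙 b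
𝟙-mono {false}         _   = z≤n
𝟙-mono {true} {true}  _   = ≤-refl
𝟙-mono {true} {false} a⇒b = ⊥-elim (a⇒b _)

𝟙-T : ∀ {a} → T a → 1 ≤ 𝟙 a
𝟙-T {true} _ = ≤-refl

𝟙-⊎ : ∀ {a b} → T a ⊎ T b → 1 ≤ 𝟙 a + 𝟙 b
𝟙-⊎ {true}          _         = s≤s z≤n
𝟙-⊎ {false} {true}  _         = s≤s z≤n
𝟙-⊎ {false} {false} (inj₁ ())
𝟙-⊎ {false} {false} (inj₂ ())

∑-const : ∀ n c → ∑[ i < n ] c ≡ n * c
∑-const zero    c = refl
∑-const (suc n) c = cong (c +_) (∑-const n c)

∑-mono-≤ : ∀ {n} {f g : Fin n → ℕ} → (∀ i → f i ≤ g i) → ∑[ i < n ] f i ≤ ∑[ i < n ] g i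
∑-mono-≤ {zero}  f≤g = z≤n
∑-mono-≤ {suc n} f≤g = +-mono-≤ (f≤g zero) (∑-mono-≤ (f≤g ∘ suc))

∑-≥ : ∀ {n} {f : Fin n → ℕ} {c} → (∀ i → c ≤ f i) → n * c ≤ ∑[ i < n ] f i
∑-≥ {n} {f} {c} c≤f = subst (_≤ ∑[ i < n ] f i) (∑-const n c) (∑-mono-≤ c≤f)

∑-> : ∀ {n} {f : Fin n → ℕ} {c} → (∀ i → c ≤ f i) → ∀ i₀ → c < f i₀ → n * c < ∑[ i < n ] f i
∑-> c≤f zero    c<f = +-mono-<-≤ c<f (∑-≥ (c≤f ∘ suc))
∑-> c≤f (suc i) c<f = +-mono-≤-< (c≤f zero) (∑-> (c≤f ∘ suc) i c<f)

∑-≥-but-one : ∀ {n} {f : Fin n → ℕ} {c} i₀ → (∀ i → i ≢ i₀ → suc c ≤ f i) → c ≤ f i₀ →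
              n * suc c ≤ suc (∑[ i < n ] f i)
∑-≥-but-one zero    c<f c≤f = s≤s (+-mono-≤ c≤f (∑-≥ λ i → c<f (suc i) λ ()))
∑-≥-but-one {n = suc n} {f} {c} (suc i₀) c<f c≤f =
  subst (suc c + n * suc c ≤_) (+-suc (f zero) (∑[ i < n ] f (suc i)))
        (+-mono-≤ (c<f zero λ ()) (∑-≥-but-one i₀ (λ i i≢i₀ → c<f (suc i) (i≢i₀ ∘ Fin.suc-injective)) c≤f))

∑-at-most-once : ∀ {n} (g : Fin n → Bool) x → (∀ i j → T (g i) → T (g j) → i ≡ j) →
                 ∑[ i < n ] (if g i then x else 0) ≤ x
∑-at-most-once {zero}  g x once = z≤n
∑-at-most-once {suc n} g x once with g zero in g₀
... | true  = ≤-trans (+-monoʳ-≤ x rest≤0) (≤-reflexive (+-identityʳ x))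
  where
  rest≡0 : ∀ i → (if g (suc i) then x else 0) ≤ 0
  rest≡0 i with g (suc i) in gᵢ
  ... | true  with () ← once zero (suc i) (subst T (sym g₀) _) (subst T (sym gᵢ) _)
  ... | false = z≤n
  rest≤0 : ∑[ i < n ] (if g (suc i) then x else 0) ≤ 0
  rest≤0 = ≤-trans (∑-mono-≤ rest≡0) (≤-reflexive (trans (∑-const n 0) (*-zeroʳ n)))
... | false = ∑-at-most-once (g ∘ suc) x λ i j gi gj → Fin.suc-injective (once (suc i) (suc j) gi gj)

resolve : ∀ {A B : Set} → A ⊎ B → ¬ B → A
resolve (inj₁ a) _  = a
resolve (inj₂ b) ¬b = ⊥-elim (¬b b)

data Cmp : Set where
  lt eq gt : Cmp

cmp : ℕ → ℕ → Cmp
cmp zero    zero    = eq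
cmp zero    (suc _) = lt
cmp (suc _) zero    = gt
cmp (suc m) (suc n) = cmp m n

_then_ : Cmp → Cmp → Cmp
lt then _ = lt
eq then o = o
gt then _ = gt

isLT isEQ : Cmp → Bool
isLT lt = true
isLT _  = false
isEQ eq = true
isEQ _  = false

cmp-< : ∀ {m n} → m < n → cmp m n ≡ lt
cmp-< {zero}  {suc n} _         = refl
cmp-< {suc m} {suc n} (s≤s m<n) = cmp-< m<n

cmp-> : ∀ {m n} → n < m → cmp m n ≡ gt
cmp-> {suc m} {zero}  _         = refl
cmp-> {suc m} {suc n} (s≤s n<m) = cmp-> n<m

cmp-refl : ∀ n → cmp n n ≡ eq
cmp-refl zero    = refl
cmp-refl (suc n) = cmp-refl n

cmp-eq⇒≡ : ∀ {m n} → cmp m n ≡ eq → m ≡ n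
cmp-eq⇒≡ {zero}  {zero}  _ = refl
cmp-eq⇒≡ {suc m} {suc n} e = cong suc (cmp-eq⇒≡ e)

isEQ-cmp⇒≡ : ∀ {m n} → T (isEQ (cmp m n)) → m ≡ n
isEQ-cmp⇒≡ {m} {n} h with cmp m n in e
... | eq = cmp-eq⇒≡ e

isLT-cmp : ∀ m n → isLT (cmp m n) ≡ (m <ᵇ n)
isLT-cmp zero    zero    = refl
isLT-cmp zero    (suc n) = refl
isLT-cmp (suc m) zero    = refl
isLT-cmp (suc m) (suc n) = isLT-cmp m n

then-eq₃ : ∀ a b c → (a then b) then c ≡ eq → a ≡ eq × b ≡ eq × c ≡ eq
then-eq₃ eq eq c c≡eq = refl , refl , c≡eq

cmp-+ : ∀ m x y → cmp (m + x) (m + y) ≡ cmp x y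
cmp-+ zero    x y = refl
cmp-+ (suc m) x y = cmp-+ m x y

cmp-radix : ∀ {M} x x′ {y y′} → y < M → y′ < M → cmp (x * M + y) (x′ * M + y′) ≡ cmp x x′ then cmp y y′
cmp-radix         zero    zero     y<M y′<M = refl
cmp-radix {M}     zero    (suc x′) y<M y′<M = cmp-< (≤-trans y<M (≤-trans (m≤m+n M (x′ * M)) (m≤m+n _ _)))
cmp-radix {M}     (suc x) zero     y<M y′<M = cmp-> (≤-trans y′<M (≤-trans (m≤m+n M (x * M)) (m≤m+n _ _)))
cmp-radix {M} (suc x) (suc x′) {y} {y′} y<M y′<M =
  trans (cong₂ cmp (+-assoc M (x * M) y) (+-assoc M (x′ * M) y′))
        (trans (cmp-+ M (x * M + y) (x′ * M + y′)) (cmp-radix x x′ y<M y′<M))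

radix-< : ∀ {M x x′ y} y′ → x < x′ → y < M → x * M + y < x′ * M + y′
radix-< {M} {x} {x′} {y} y′ x<x′ y<M = begin-strict
  x * M + y    <⟨ +-monoʳ-< (x * M) y<M ⟩
  x * M + M    ≡⟨ +-comm (x * M) M ⟩
  suc x * M    ≤⟨ *-monoˡ-≤ M x<x′ ⟩
  x′ * M       ≤⟨ m≤m+n (x′ * M) y′ ⟩
  x′ * M + y′  ∎
  where open ≤-Reasoning

<ᵇ-irrefl : ∀ n → (n <ᵇ n) ≡ false
<ᵇ-irrefl zero    = refl
<ᵇ-irrefl (suc n) = <ᵇ-irrefl n

<ᵇ-suc : ∀ n → (n <ᵇ suc n) ≡ true
<ᵇ-suc zero    = refl
<ᵇ-suc (suc n) = <ᵇ-suc n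

<ᵇ-step : ∀ m n → m ≢ n → (m <ᵇ n) ≡ (m <ᵇ suc n)
<ᵇ-step zero    zero    m≢n = ⊥-elim (m≢n refl)
<ᵇ-step zero    (suc n) _   = refl
<ᵇ-step (suc m) zero    _   = refl
<ᵇ-step (suc m) (suc n) m≢n = <ᵇ-step m n (m≢n ∘ cong suc)

≮ᵇ-suc⇒≮ᵇ : ∀ m n → T (not (m <ᵇ suc n)) → T (not (m <ᵇ n))
≮ᵇ-suc⇒≮ᵇ m       zero    _ = _
≮ᵇ-suc⇒≮ᵇ (suc m) (suc n) h = ≮ᵇ-suc⇒≮ᵇ m n h

-- Cyclic successors of positions

CycSucc? : ∀ {k} (j j′ : Fin k) → Dec (CycSucc j j′)
CycSucc? {k} j j′ = (toℕ j′ ≟ suc (toℕ j)) ⊎-dec ((toℕ j′ ≟ 0) ×-dec (suc (toℕ j) ≟ k))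

cyclic-closed : ∀ {k} (P : Fin k → Set) → (∀ {j′ j} → CycSucc j′ j → P j′ → P j) →
                ∀ {a} → P a → ∀ b → P b
cyclic-closed {suc m} P closed {a} Pa = <-weakInduction P P₀ next
  where
  next : ∀ j → P (inject₁ j) → P (suc j)
  next j = closed (inj₁ (cong suc (sym (Fin.toℕ-inject₁ j))))
  P₀ : P zero
  P₀ = closed (inj₂ (refl , cong suc (Fin.toℕ-fromℕ m))) (<-weakInduction-startingFrom P Pa next (Fin.≤fromℕ a))

transition : ∀ {k} {Q : Fin k → Set} → U.Decidable Q → ∀ {a b} → ¬ Q a → Q b →
             ∃ λ j′ → ∃ λ j → CycSucc j′ j × ¬ Q j′ × Q j
transition {Q = Q} Q? {a} ¬Qa Qb with Fin.any? (λ j′ → Fin.any? λ j → CycSucc? j′ j ×-dec ¬? (Q? j′) ×-dec Q? j)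
... | yes (j′ , j , found) = j′ , j , found
... | no none = ⊥-elim (cyclic-closed (¬_ ∘ Q) stays-false ¬Qa _ Qb)
  where
  stays-false : ∀ {j′ j} → CycSucc j′ j → ¬ Q j′ → ¬ Q j
  stays-false {j′} {j} j′→j ¬Qj′ Qj = none (j′ , j , j′→j , ¬Qj′ , Qj)

-- Reconfiguration in finite graphs

count : ∀ {A : Set} → (A → Bool) → List A → ℕ
count X xs = length (filter (λ v → T? (X v)) xs)

module _ {A : Set} (X : A → Bool) where

  count-∷ : ∀ x xs → count X (x ∷ xs) ≡ 𝟙 (X x) + count X xs
  count-∷ x xs with X x
  ... | true  = refl
  ... | false = refl

  count-++ : ∀ xs ys → count X (xs ++ ys) ≡ count X xs + count X ys
  count-++ xs ys = trans (cong length (filter-++ (λ v → T? (X v)) xs ys)) (length-++ (filter (λ v → T? (X v)) xs))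

module _ {A : Set} {X Y : A → Bool} where

  count-cong : X ≗ Y → ∀ xs → count X xs ≡ count Y xs
  count-cong X≗Y []       = refl
  count-cong X≗Y (x ∷ xs) =
    trans (count-∷ X x xs) (trans (cong₂ _+_ (cong 𝟙 (X≗Y x)) (count-cong X≗Y xs)) (sym (count-∷ Y x xs)))

  count-mono : (∀ v → T (X v) → T (Y v)) → ∀ xs → count X xs ≤ count Y xs
  count-mono X⊆Y []       = z≤n
  count-mono X⊆Y (x ∷ xs) rewrite count-∷ X x xs | count-∷ Y x xs =
    +-mono-≤ (𝟙-mono (X⊆Y x)) (count-mono X⊆Y xs)

  count-mono-< : (∀ v → T (X v) → T (Y v)) → ∀ {v xs} → v ∈ xs → X v ≡ false → Y v ≡ true →
                 count X xs < count Y xs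
  count-mono-< X⊆Y {xs = x ∷ xs} (here refl) Xv Yv
    rewrite count-∷ X x xs | count-∷ Y x xs | Xv | Yv = s≤s (count-mono X⊆Y xs)
  count-mono-< X⊆Y {xs = x ∷ xs} (there v∈xs) Xv Yv
    rewrite count-∷ X x xs | count-∷ Y x xs =
    +-mono-≤-< (𝟙-mono (X⊆Y x)) (count-mono-< X⊆Y v∈xs Xv Yv)

module _ {G : FinGraph} where

  size-cong : ∀ {X Y} → X ≗ Y → size G X ≡ size G Y
  size-cong X≗Y = count-cong X≗Y (vertices G)

  IsVertexCover-cong : ∀ {X Y} → X ≗ Y → IsVertexCover G X → IsVertexCover G Y
  IsVertexCover-cong X≗Y cover u v uv with cover u v uv
  ... | inj₁ Xu = inj₁ (subst T (X≗Y u) Xu)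
  ... | inj₂ Xv = inj₂ (subst T (X≗Y v) Xv)

  Reconf-congˡ : ∀ {b ℓ X X′ Z} → X ≗ X′ → Reconf G b ℓ X Z → Reconf G b ℓ X′ Z
  Reconf-congˡ X≗X′ (done X≗Z)                 = done λ v → trans (sym (X≗X′ v)) (X≗Z v)
  Reconf-congˡ X≗X′ (step (v , Xv≢Yv , same) cover small rest) =
    step (v , (λ X′v≡Yv → Xv≢Yv (trans (X≗X′ v) X′v≡Yv)) , λ w w≢v → trans (sym (X≗X′ w)) (same w w≢v))
         cover small rest

  Reconf-congʳ : ∀ {b ℓ X Z Z′} → Z ≗ Z′ → Reconf G b ℓ X Z → Reconf G b ℓ X Z′
  Reconf-congʳ Z≗Z′ (done X≗Z)             = done λ v → trans (X≗Z v) (Z≗Z′ v)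
  Reconf-congʳ Z≗Z′ (step one cover small rest) = step one cover small (Reconf-congʳ Z≗Z′ rest)

  Reconf-weaken : ∀ {b ℓ ℓ′ X Z} → ℓ ≤ ℓ′ → Reconf G b ℓ X Z → Reconf G b ℓ′ X Z
  Reconf-weaken ℓ≤ℓ′        (done X≗Z)               = done X≗Z
  Reconf-weaken (s≤s ℓ≤ℓ′) (step one cover small rest) = step one cover small (Reconf-weaken ℓ≤ℓ′ rest)

Searchable : Set → Set₁
Searchable A = ∀ {P : A → Set} → U.Decidable P → Dec (∃ P)

module _ {A : Set} (search : Searchable A) where

  all? : ∀ {P : A → Set} → U.Decidable P → Dec (∀ x → P x)
  all? P? with search (¬? ∘ P?)
  ... | yes (x , ¬Px) = no λ ∀P → ¬Px (∀P x)
  ... | no ∄¬P        = yes λ x → decidable-stable (P? x) λ ¬Px → ∄¬P (x , ¬Px)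

enumeration⇒searchable : ∀ {A : Set} (xs : List A) → (∀ x → x ∈ xs) → Searchable A
enumeration⇒searchable xs complete P? with any? P? xs
... | yes Pxs = yes (satisfied Pxs)
... | no ¬Pxs = no λ (x , Px) → ¬Pxs (lose (complete x) Px)

isVertexCover? : ∀ (G : FinGraph) → Searchable (V G) → (∀ u v → Dec (Adj G u v)) →
                 ∀ X → Dec (IsVertexCover G X)
isVertexCover? G search adj? X =
  all? search λ u → all? search λ v → adj? u v →-dec (T? (X u) ⊎-dec T? (X v))

module ReconfDecision (G : FinGraph) (_≟_ : DecidableEquality (V G)) (search : Searchable (V G))
                      (isVertexCover? : ∀ X → Dec (IsVertexCover G X)) where

  toggle : VSet G → V G → VSet G
  toggle X v u = if does (u ≟ v) then not (X u) else X u

  toggle-at : ∀ X v → toggle X v v ≡ not (X v)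
  toggle-at X v with v ≟ v
  ... | yes _   = refl
  ... | no v≢v = ⊥-elim (v≢v refl)

  toggle-off : ∀ X {v u} → u ≢ v → toggle X v u ≡ X u
  toggle-off X {v} {u} u≢v with u ≟ v
  ... | yes u≡v = ⊥-elim (u≢v u≡v)
  ... | no _    = refl

  toggle-step : ∀ X v → OneStep G X (toggle X v)
  toggle-step X v = v , x≢not (X v) ∘ (λ e → trans e (toggle-at X v)) , λ w w≢v → sym (toggle-off X w≢v)
    where
    x≢not : ∀ x → x ≢ not x
    x≢not true  ()
    x≢not false ()

  step≗toggle : ∀ {X Y} (one : OneStep G X Y) → Y ≗ toggle X (proj₁ one)
  step≗toggle {X} {Y} (v , Xv≢Yv , same) u with u ≟ v
  ... | no u≢v   = sym (same u u≢v)
  ... | yes refl = flipped (X u) (Y u) Xv≢Yv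
    where
    flipped : ∀ a b → a ≢ b → b ≡ not a
    flipped true  false _   = refl
    flipped false true  _   = refl
    flipped true  true  a≢b = ⊥-elim (a≢b refl)
    flipped false false a≢b = ⊥-elim (a≢b refl)

  reconf? : ∀ b ℓ X Z → Dec (Reconf G b ℓ X Z)
  reconf? b ℓ X Z with all? search (λ v → X v ≟ᵇ Z v)
  ... | yes X≗Z = yes (done X≗Z)
  reconf? b zero    X Z | no X≉Z = no λ { (done X≗Z) → X≉Z X≗Z }
  reconf? b (suc ℓ) X Z | no X≉Z with search (λ v → isVertexCover? (toggle X v) ×-dec
                                                    (size G (toggle X v) ≤? b) ×-dec reconf? b ℓ (toggle X v) Z)
  ... | yes (v , cover , small , rest) = yes (step (toggle-step X v) cover small rest)
  ... | no ∄v = no λ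
    { (done X≗Z) → X≉Z X≗Z
    ; (step one cover small rest) → ∄v (proj₁ one ,
        IsVertexCover-cong {G = G} (step≗toggle one) cover ,
        subst (_≤ b) (size-cong {G = G} (step≗toggle one)) small ,
        Reconf-congˡ (step≗toggle one) rest) }

module Schedule (G : FinGraph) (search : Searchable (V G)) (complete : ∀ v → v ∈ vertices G)
                (start target : VSet G) (start≢target : ∀ v → start v ≢ target v)
                (rank : V G → ℕ) (rank-injective : ∀ {u v} → rank u ≡ rank v → u ≡ v) where

  at : ℕ → VSet G
  at t v = if rank v <ᵇ t then target v else start v

  pending : ℕ → ℕ
  pending t = size G (λ v → not (rank v <ᵇ t))

  at-covers : ∀ {u v} t → rank u < rank v → T (target u) → T (start v) → T (at t u) ⊎ T (at t v)
  at-covers {u} {v} t ru<rv tu sv with rank u <ᵇ t in ru<t | rank v <ᵇ t in rv<t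
  ... | _     | false = inj₂ sv
  ... | true  | true  = inj₁ tu
  ... | false | true  = ⊥-elim (subst T ru<t (<⇒<ᵇ (<-trans ru<rv (<ᵇ⇒< (rank v) t (subst T (sym rv<t) _)))))

  at-stable : ∀ {t} u → rank u ≢ t → at t u ≡ at (suc t) u
  at-stable {t} u ru≢t = cong (if_then target u else start u) (<ᵇ-step (rank u) t ru≢t)

  switch : ∀ v → OneStep G (at (rank v)) (at (suc (rank v)))
  switch v = v , switched , λ w w≢v → at-stable w (w≢v ∘ rank-injective)
    where
    switched : at (rank v) v ≢ at (suc (rank v)) v
    switched rewrite <ᵇ-irrefl (rank v) | <ᵇ-suc (rank v) = start≢target v

  pending-mono : ∀ t → pending (suc t) ≤ pending t
  pending-mono t = count-mono (λ w → ≮ᵇ-suc⇒≮ᵇ (rank w) t) (vertices G)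

  pending-drop : ∀ v → suc (pending (suc (rank v))) ≤ pending (rank v)
  pending-drop v = count-mono-< (λ w → ≮ᵇ-suc⇒≮ᵇ (rank w) (rank v)) (complete v)
                                (cong not (<ᵇ-suc (rank v))) (cong not (<ᵇ-irrefl (rank v)))

  advance : ∀ {b Z} → (∀ t → IsVertexCover G (at t)) → (∀ t → size G (at t) ≤ b) →
            ∀ t → Reconf G b (pending (suc t)) (at (suc t)) Z → Reconf G b (pending t) (at t) Z
  advance cover small t rest with search (λ v → rank v ≟ t)
  ... | yes (v , refl) = Reconf-weaken (pending-drop v) (step (switch v) (cover (suc t)) (small (suc t)) rest)
  ... | no ∄v =
    Reconf-weaken (pending-mono t) (Reconf-congˡ (λ u → sym (at-stable u λ ru≡t → ∄v (u , ru≡t))) rest)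

  schedule : ∀ {b} → (∀ t → IsVertexCover G (at t)) → (∀ t → size G (at t) ≤ b) →
             ∀ d t → Reconf G b (pending t) (at t) (at (d + t))
  schedule cover small zero    t = done λ _ → refl
  schedule {b} cover small (suc d) t =
    advance cover small t (subst (Reconf G b (pending (suc t)) (at (suc t)) ∘ at) (+-suc d t)
                                 (schedule cover small d (suc t)))

threshold : ∀ {P : ℕ → Set} → U.Decidable P → ∀ {a} d → ¬ P a → P (d + a) →
            Σ ℕ λ m → a ≤ m × m < d + a × ¬ P m × P (suc m)
threshold P? zero    ¬Pa Pa = ⊥-elim (¬Pa Pa)
threshold {P} P? {a} (suc d) ¬Pa Pd+a with P? (suc a)
... | yes Pa+1 = a , ≤-refl , s≤s (m≤n+m a d) , ¬Pa , Pa+1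
... | no ¬Pa+1 with threshold P? d ¬Pa+1 (subst P (sym (+-suc d a)) Pd+a)
...   | m , a<m , m<d+a+1 , ¬Pm , Pm+1 = m , <⇒≤ a<m , subst (m <_) (+-suc d a) m<d+a+1 , ¬Pm , Pm+1

-- The graph W_k and its cells

_≟ˢ_ : DecidableEquality Side
up  ≟ˢ up  = yes refl
up  ≟ˢ low = no λ ()
low ≟ˢ up  = no λ ()
low ≟ˢ low = yes refl

_≟ᵖ_ : DecidableEquality Part
bead     ≟ᵖ bead     = yes refl
bead     ≟ᵖ sequin _ = no λ ()
sequin _ ≟ᵖ bead     = no λ ()
sequin s ≟ᵖ sequin t = map′ (cong sequin) (λ { refl → refl }) (s Fin.≟ t)

_≟ᵛ_ : ∀ {k} → DecidableEquality (WV k)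
wv x i j p ≟ᵛ wv y i′ j′ q =
  map′ (λ { (refl , refl , refl , refl) → refl }) (λ { refl → refl , refl , refl , refl })
       (x ≟ˢ y ×-dec i Fin.≟ i′ ×-dec j Fin.≟ j′ ×-dec p ≟ᵖ q)

WE? : ∀ {k} (u v : WV k) → Dec (WE u v)
WE? (wv x i j (sequin s)) (wv y i′ j′ bead) with x ≟ˢ y | i Fin.≟ i′
... | yes refl | yes refl with j Fin.≟ j′ | CycSucc? j j′
...   | yes refl | _        = yes (seq-left x i j s)
...   | no _     | yes j→j′ = yes (seq-right x i j j′ s j→j′)
...   | no j≢j′  | no ¬j→j′ =
  no λ { (seq-left _ _ _ _) → j≢j′ refl ; (seq-right _ _ _ _ _ j→j′) → ¬j→j′ j→j′ }
WE? (wv x i j (sequin s)) (wv y i′ j′ bead) | no x≢y | _ =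
  no λ { (seq-left _ _ _ _) → x≢y refl ; (seq-right _ _ _ _ _ _) → x≢y refl }
WE? (wv x i j (sequin s)) (wv y i′ j′ bead) | yes _ | no i≢i′ =
  no λ { (seq-left _ _ _ _) → i≢i′ refl ; (seq-right _ _ _ _ _ _) → i≢i′ refl }
WE? (wv low i j (sequin s)) (wv up j′ i′ (sequin t)) with i Fin.≟ i′ | j Fin.≟ j′
... | yes refl | yes refl = yes (cross i j s t)
... | no i≢i′  | _        = no λ { (cross _ _ _ _) → i≢i′ refl }
... | yes _    | no j≢j′  = no λ { (cross _ _ _ _) → j≢j′ refl }
WE? (wv up  _ _ (sequin _)) (wv _   _ _ (sequin _)) = no λ ()
WE? (wv low _ _ (sequin _)) (wv low _ _ (sequin _)) = no λ ()
WE? (wv _   _ _ bead)       _                       = no λ ()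

module _ {k : ℕ} where

  slotVertices : Side → Fin k → Fin k → List (WV k)
  slotVertices x i j = map (wv x i j) allParts

  necklaceVertices : Side → Fin k → List (WV k)
  necklaceVertices x i = concatMap (slotVertices x i) (allFin k)

  sideVertices : Side → List (WV k)
  sideVertices x = concatMap (necklaceVertices x) (allFin k)

  allWV-complete : ∀ v → v ∈ allWV k
  allWV-complete (wv x i j p) =
    ∈-concat⁺′ (∈-concat⁺′ (∈-concat⁺′ (∈-map⁺ (wv x i j) (part∈ p))
                                       (∈-map⁺ (slotVertices x i) (∈-allFin j)))
                           (∈-map⁺ (necklaceVertices x) (∈-allFin i)))
               (∈-map⁺ sideVertices (side∈ x))
    where
    side∈ : ∀ x → x ∈ allSides
    side∈ up  = here refl
    side∈ low = there (here refl)
    part∈ : ∀ p → p ∈ allParts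
    part∈ bead                = here refl
    part∈ (sequin zero)       = there (here refl)
    part∈ (sequin (suc zero)) = there (there (here refl))

searchWV : ∀ {k} → Searchable (WV k)
searchWV {k} = enumeration⇒searchable (allWV k) allWV-complete

isVertexCoverW? : ∀ {k} (X : VSet (W k)) → Dec (IsVertexCover (W k) X)
isVertexCoverW? {k} = isVertexCover? (W k) searchWV λ u v → WE? u v ⊎-dec WE? v u

s₀ s₁ : Part
s₀ = sequin zero
s₁ = sequin (suc zero)

module _ {k : ℕ} (X : VSet (W k)) where

  slotWeight : Side → Fin k → Fin k → ℕ
  slotWeight x i j = 𝟙 (X (wv x i j bead)) + (𝟙 (X (wv x i j s₀)) + 𝟙 (X (wv x i j s₁)))

  -- the cross edges join the two sequin pairs of a cell
  cellWeight : Fin k → Fin k → ℕ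
  cellWeight i j = slotWeight up i j + slotWeight low j i

  count-slot : ∀ x i j → count X (slotVertices x i j) ≡ slotWeight x i j
  count-slot x i j rewrite count-∷ X (wv x i j bead) (map (wv x i j) (s₀ ∷ s₁ ∷ []))
                         | count-∷ X (wv x i j s₀) (wv x i j s₁ ∷ [])
                         | count-∷ X (wv x i j s₁) [] =
    cong (λ n → 𝟙 (X (wv x i j bead)) + (𝟙 (X (wv x i j s₀)) + n)) (+-identityʳ _)

  count-concatMap : ∀ {A : Set} {n} (f : A → List (WV k)) (g : Fin n → A) →
                    count X (concatMap f (tabulate g)) ≡ ∑[ i < n ] count X (f (g i))
  count-concatMap {n = zero}  f g = refl
  count-concatMap {n = suc n} f g =
    trans (count-++ X (f (g zero)) _) (cong (count X (f (g zero)) +_) (count-concatMap f (g ∘ suc)))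

  count-side : ∀ x → count X (sideVertices x) ≡ ∑[ i < k ] ∑[ j < k ] slotWeight x i j
  count-side x = begin
    count X (sideVertices x)
      ≡⟨ count-concatMap (necklaceVertices x) id ⟩
    ∑[ i < k ] count X (necklaceVertices x i)
      ≡⟨ sum-cong-≗ (λ i → count-concatMap (slotVertices x i) id) ⟩
    ∑[ i < k ] ∑[ j < k ] count X (slotVertices x i j)
      ≡⟨ sum-cong-≗ (λ i → sum-cong-≗ (count-slot x i)) ⟩
    ∑[ i < k ] ∑[ j < k ] slotWeight x i j ∎
    where open ≡-Reasoning

  size-cells : size (W k) X ≡ ∑[ i < k ] ∑[ j < k ] cellWeight i j
  size-cells = begin
    count X (sideVertices up ++ sideVertices low ++ [])
      ≡⟨ count-++ X (sideVertices up) _ ⟩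
    count X (sideVertices up) + count X (sideVertices low ++ [])
      ≡⟨ cong (count X (sideVertices up) +_) (trans (count-++ X (sideVertices low) []) (+-identityʳ _)) ⟩
    count X (sideVertices up) + count X (sideVertices low)
      ≡⟨ cong₂ _+_ (count-side up) (trans (count-side low) (∑-comm (slotWeight low))) ⟩
    ∑[ i < k ] ∑[ j < k ] slotWeight up i j + ∑[ i < k ] ∑[ j < k ] slotWeight low j i
      ≡⟨ ∑-distrib-+ (λ i → ∑[ j < k ] slotWeight up i j) _ ⟨
    ∑[ i < k ] (∑[ j < k ] slotWeight up i j + ∑[ j < k ] slotWeight low j i)
      ≡⟨ sum-cong-≗ (λ i → ∑-distrib-+ (slotWeight up i) _) ⟨
    ∑[ i < k ] ∑[ j < k ] cellWeight i j ∎
    where open ≡-Reasoning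

size-uniform : ∀ {k} (X : VSet (W k)) c → (∀ i j → cellWeight X i j ≡ c) → size (W k) X ≡ c * (k * k)
size-uniform {k} X c uniform = begin
  size (W k) X                          ≡⟨ size-cells X ⟩
  ∑[ i < k ] ∑[ j < k ] cellWeight X i j ≡⟨ sum-cong-≗ (λ i → trans (sum-cong-≗ (uniform i)) (∑-const k c)) ⟩
  ∑[ i < k ] (k * c)                    ≡⟨ ∑-const k (k * c) ⟩
  k * (k * c)                           ≡⟨ trans (sym (*-assoc k k c)) (*-comm (k * k) c) ⟩
  c * (k * k)                           ∎
  where open ≡-Reasoning

cellWeight-bits : ∀ {k} {X : VSet (W k)} {i j a b c d e f} →
                  X (wv up i j bead) ≡ a → X (wv up i j s₀) ≡ b → X (wv up i j s₁) ≡ c →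
                  X (wv low j i bead) ≡ d → X (wv low j i s₀) ≡ e → X (wv low j i s₁) ≡ f →
                  cellWeight X i j ≡ (𝟙 a + (𝟙 b + 𝟙 c)) + (𝟙 d + (𝟙 e + 𝟙 f))
cellWeight-bits refl refl refl refl refl refl = refl

-- Lower bound

slot≥1 : ∀ {a b} c → T a ⊎ T b → 1 ≤ 𝟙 a + (𝟙 b + 𝟙 c)
slot≥1 {a} {b} c ab = ≤-trans (𝟙-⊎ ab) (+-monoʳ-≤ (𝟙 a) (m≤m+n (𝟙 b) (𝟙 c)))

slot≥2 : ∀ a {b c} → T b → T c → 2 ≤ 𝟙 a + (𝟙 b + 𝟙 c)
slot≥2 a b c = ≤-trans (+-mono-≤ (𝟙-T b) (𝟙-T c)) (m≤n+m _ (𝟙 a))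

slot≥3 : ∀ {a b c} → T a → T b → T c → 3 ≤ 𝟙 a + (𝟙 b + 𝟙 c)
slot≥3 a b c = +-mono-≤ (𝟙-T a) (+-mono-≤ (𝟙-T b) (𝟙-T c))

regroup-pairs : ∀ a b c d e f → a + b + (d + e) + (c + f) ≡ a + (b + c) + (d + (e + f))
regroup-pairs = solve-∀

module _ {k : ℕ} (Y : VSet (W k)) where

  UpperFull LowerFull : Fin k → Fin k → Set
  UpperFull i j = T (Y (wv up i j s₀)) × T (Y (wv up i j s₁))
  LowerFull i j = T (Y (wv low j i s₀)) × T (Y (wv low j i s₁))

  UpperFull? : ∀ i j → Dec (UpperFull i j)
  UpperFull? i j = T? _ ×-dec T? _

  LowerFull? : ∀ i j → Dec (LowerFull i j)
  LowerFull? i j = T? _ ×-dec T? _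

  module _ (cover : IsVertexCover (W k) Y) where

    covers : ∀ {u v} → WE u v → T (Y u) ⊎ T (Y v)
    covers {u} {v} e = cover u v (inj₁ e)

    3≤cellWeight : ∀ i j → 3 ≤ cellWeight Y i j
    3≤cellWeight i j = subst (3 ≤_) (regroup-pairs (bit (wv up i j bead)) (bit (wv up i j s₀)) (bit (wv up i j s₁))
                                                 (bit (wv low j i bead)) (bit (wv low j i s₀)) (bit (wv low j i s₁)))
      (+-mono-≤ (+-mono-≤ (𝟙-⊎ (swap (covers (seq-left up i j zero))))
                          (𝟙-⊎ (swap (covers (seq-left low j i zero)))))
                (𝟙-⊎ (swap (covers (cross j i (suc zero) (suc zero))))))
      where bit = λ v → 𝟙 (Y v)

    4≤cellWeight-upper : ∀ {i j} → T (Y (wv up i j bead)) → UpperFull i j → 4 ≤ cellWeight Y i j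
    4≤cellWeight-upper {i} {j} b (s , s′) =
      +-mono-≤ (slot≥3 b s s′) (slot≥1 _ (swap (covers (seq-left low j i zero))))

    4≤cellWeight-lower : ∀ {i j} → T (Y (wv low j i bead)) → LowerFull i j → 4 ≤ cellWeight Y i j
    4≤cellWeight-lower {i} {j} b (s , s′) =
      +-mono-≤ (slot≥1 _ (swap (covers (seq-left up i j zero)))) (slot≥3 b s s′)

    ¬UpperFull⇒LowerFull : ∀ {i j} → ¬ UpperFull i j → LowerFull i j
    ¬UpperFull⇒LowerFull {i} {j} ¬full with T? (Y (wv up i j s₀)) | T? (Y (wv up i j s₁))
    ... | yes u₀ | yes u₁ = ⊥-elim (¬full (u₀ , u₁))
    ... | no ¬u₀ | _      = resolve (covers (cross j i zero zero)) ¬u₀ ,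
                            resolve (covers (cross j i (suc zero) zero)) ¬u₀
    ... | yes _  | no ¬u₁ = resolve (covers (cross j i zero (suc zero))) ¬u₁ ,
                            resolve (covers (cross j i (suc zero) (suc zero))) ¬u₁

    ¬UpperFull⇒bead : ∀ {i j′ j} → ¬ UpperFull i j′ → CycSucc j′ j → T (Y (wv up i j bead))
    ¬UpperFull⇒bead {i} {j′} {j} ¬full j′→j with T? (Y (wv up i j′ s₀)) | T? (Y (wv up i j′ s₁))
    ... | yes u₀ | yes u₁ = ⊥-elim (¬full (u₀ , u₁))
    ... | no ¬u₀ | _      = resolve (swap (covers (seq-right up i j′ j zero j′→j))) ¬u₀
    ... | yes _  | no ¬u₁ = resolve (swap (covers (seq-right up i j′ j (suc zero) j′→j))) ¬u₁

    ¬LowerFull⇒bead : ∀ {i′ i j} → ¬ LowerFull i′ j → CycSucc i′ i → T (Y (wv low j i bead))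
    ¬LowerFull⇒bead {i′} {i} {j} ¬full i′→i with T? (Y (wv low j i′ s₀)) | T? (Y (wv low j i′ s₁))
    ... | yes l₀ | yes l₁ = ⊥-elim (¬full (l₀ , l₁))
    ... | no ¬l₀ | _      = resolve (swap (covers (seq-right low j i′ i zero i′→i))) ¬l₀
    ... | yes _  | no ¬l₁ = resolve (swap (covers (seq-right low j i′ i (suc zero) i′→i))) ¬l₁

4≤cellWeight-full : ∀ {k} {Y : VSet (W k)} {i j} → UpperFull Y i j → LowerFull Y i j → 4 ≤ cellWeight Y i j
4≤cellWeight-full {Y = Y} {i} {j} (u₀ , u₁) (l₀ , l₁) =
  +-mono-≤ (slot≥2 (Y (wv up i j bead)) u₀ u₁) (slot≥2 (Y (wv low j i bead)) l₀ l₁)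

module _ {k : ℕ} {Y : VSet (W k)} (cover : IsVertexCover (W k) Y) where

  size-lower-bound : (∀ i → ∃ (UpperFull Y i)) → ∀ r j₀ → (∀ j → j ≢ j₀ → ¬ UpperFull Y r j) →
                     k * suc (k * 3) ≤ suc (size (W k) Y)
  size-lower-bound complete r j₀ incomplete
    rewrite size-cells Y with Fin.any? (λ z → Fin.all? (UpperFull? Y z))
  ... | no ∄full-row = ≤-trans (∑-≥ row-bound) (n≤1+n _)
    where
    row-bound : ∀ i → suc (k * 3) ≤ ∑[ j < k ] cellWeight Y i j
    row-bound i with Fin.¬∀⟶∃¬ k (UpperFull Y i) (UpperFull? Y i) (λ full → ∄full-row (i , full))
    ... | _ , ¬full with transition (UpperFull? Y i) ¬full (proj₂ (complete i))
    ...   | j′ , j , j′→j , ¬full′ , full =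
      ∑-> (3≤cellWeight Y cover i) j (4≤cellWeight-upper Y cover (¬UpperFull⇒bead Y cover ¬full′ j′→j) full)
  ... | yes (z , full-row) =
    subst (λ n → k * suc (k * 3) ≤ suc n) (sym (∑-comm (cellWeight Y)))
          (∑-≥-but-one j₀ column-bound (∑-≥ λ i → 3≤cellWeight Y cover i j₀))
    where
    column-bound : ∀ j → j ≢ j₀ → suc (k * 3) ≤ ∑[ i < k ] cellWeight Y i j
    column-bound j j≢j₀ with LowerFull? Y z j
    ... | yes lower-full = ∑-> (λ i → 3≤cellWeight Y cover i j) z (4≤cellWeight-full {Y = Y} (full-row j) lower-full)
    ... | no ¬lower-full with transition (λ i → LowerFull? Y i j) ¬lower-full
                                         (¬UpperFull⇒LowerFull Y cover (incomplete j j≢j₀))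
    ...   | i′ , i , i′→i , ¬full′ , full =
      ∑-> (λ i → 3≤cellWeight Y cover i j) i
          (4≤cellWeight-lower Y cover (¬LowerFull⇒bead Y cover ¬full′ i′→i) full)

module _ {k : ℕ} {B : ℕ} (B<bound : suc B < k * suc (k * 3)) where

  never-completes : ∀ {ℓ X} r → (∀ j → ¬ UpperFull X r j) → ¬ Reconf (W k) B ℓ X Tset
  never-completes r incomplete (done X≗T) =
    incomplete r (subst T (sym (X≗T (wv up r r s₀))) _ , subst T (sym (X≗T (wv up r r s₁))) _)
  never-completes {X = X} r incomplete (step {Y = Y} (v , _ , same) cover small rest)
    with Fin.any? (λ r′ → Fin.all? λ j → ¬? (UpperFull? Y r′ j))
  ... | yes (r′ , incomplete′) = never-completes r′ incomplete′ rest
  ... | no ∄incomplete-row =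
    <⇒≱ B<bound (≤-trans (size-lower-bound cover complete r (WV.pos v) still-incomplete) (s≤s small))
    where
    complete : ∀ i → ∃ (UpperFull Y i)
    complete i with Fin.¬∀⟶∃¬ k _ (λ j → ¬? (UpperFull? Y i j)) (λ none → ∄incomplete-row (i , none))
    ... | j , ¬¬full = j , decidable-stable (UpperFull? Y i j) ¬¬full
    still-incomplete : ∀ j → j ≢ WV.pos v → ¬ UpperFull Y r j
    still-incomplete j j≢pos (u₀ , u₁) = incomplete j (unchanged u₀ , unchanged u₁)
      where
      unchanged : ∀ {s} → T (Y (wv up r j s)) → T (X (wv up r j s))
      unchanged = subst T (sym (same _ (j≢pos ∘ cong WV.pos)))

-- Upper bound: switching the vertices in the order of their rank

sequin<4+ : ∀ (s : Fin 2) n → toℕ s < 4 + n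
sequin<4+ s n = ≤-trans (Fin.toℕ<n s) (≤-trans (s≤s (s≤s z≤n)) (m≤m+n 4 n))

module _ {k : ℕ} where

  -- bead 0 of an upper necklace follows the last sequin pair, so it gets the extra column k
  beadColumn : Fin k → ℕ
  beadColumn zero    = k
  beadColumn (suc j) = suc (toℕ j)

  -- row r + 1 treats U_r and the lower pairs at position r column by column: add the upper pair,
  -- remove the upper bead, add the lower bead at position r + 1, remove the lower pair
  row column slot : WV k → ℕ
  row    (wv up  i _ _)          = suc (toℕ i)
  row    (wv low _ j bead)       = toℕ j
  row    (wv low _ j (sequin _)) = suc (toℕ j)
  column (wv up  _ j bead)       = beadColumn j
  column (wv up  _ j (sequin _)) = toℕ j
  column (wv low i _ _)          = toℕ i
  slot   (wv up  _ _ (sequin s)) = toℕ s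
  slot   (wv up  _ _ bead)       = 2
  slot   (wv low _ _ bead)       = 3
  slot   (wv low _ _ (sequin s)) = 4 + toℕ s

  row≤ : ∀ v → row v ≤ k
  row≤ (wv up  i _ _)          = Fin.toℕ<n i
  row≤ (wv low _ j bead)       = <⇒≤ (Fin.toℕ<n j)
  row≤ (wv low _ j (sequin _)) = Fin.toℕ<n j

  column< : ∀ v → column v < suc k
  column< (wv up  _ zero    bead)       = ≤-refl
  column< (wv up  _ (suc j) bead)       = m<n⇒m<1+n (Fin.toℕ<n (suc j))
  column< (wv up  _ j       (sequin _)) = m<n⇒m<1+n (Fin.toℕ<n j)
  column< (wv low i _ _)                = m<n⇒m<1+n (Fin.toℕ<n i)

  slot<6 : ∀ v → slot v < 6
  slot<6 (wv up  _ _ (sequin s))          = sequin<4+ s 2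
  slot<6 (wv up  _ _ bead)                = s≤s (s≤s (s≤s z≤n))
  slot<6 (wv low _ _ bead)                = s≤s (s≤s (s≤s (s≤s z≤n)))
  slot<6 (wv low _ _ (sequin zero))       = s≤s (s≤s (s≤s (s≤s (s≤s z≤n))))
  slot<6 (wv low _ _ (sequin (suc zero))) = ≤-refl

-- (row , column , slot) in mixed radix, so that ranks compare lexicographically
code : ℕ → ℕ → ℕ → ℕ → ℕ
code k a b c = (a * suc k + b) * 6 + c

rank : ∀ {k} → WV k → ℕ
rank {k} v = code k (row v) (column v) (slot v)

module _ {k : ℕ} where

  cmp-rank : ∀ v {R J σ} → J < suc k → σ < 6 →
             cmp (rank v) (code k R J σ) ≡ (cmp (row v) R then cmp (column v) J) then cmp (slot v) σ
  cmp-rank v {R} {J} {σ} J<M σ<6 =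
    trans (cmp-radix (row v * suc k + column v) (R * suc k + J) (slot<6 v) σ<6)
          (cong (_then cmp (slot v) σ) (cmp-radix (row v) R (column< v) J<M))

module _ {k : ℕ} (u v : WV k) where

  rank-<-row : row u < row v → rank u < rank v
  rank-<-row r<r′ = radix-< (slot v) (radix-< (column v) r<r′ (column< u)) (slot<6 u)

  rank-<-column : row u ≡ row v → column u < column v → rank u < rank v
  rank-<-column r≡r′ c<c′ = subst (λ r → rank u < code k r (column v) (slot v)) r≡r′
                                  (radix-< (slot v) (+-monoʳ-< (row u * suc k) c<c′) (slot<6 u))

  rank-<-slot : row u ≡ row v → column u ≡ column v → slot u < slot v → rank u < rank v
  rank-<-slot r≡r′ c≡c′ s<s′ = subst₂ (λ r c → rank u < code k r c (slot v)) r≡r′ c≡c′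
                                      (+-monoʳ-< ((row u * suc k + column u) * 6) s<s′)

Ranked : ∀ {k} → WV k → WV k → Set
Ranked u v = rank u < rank v × T (Tset u) × T (Sset v)

-- on every edge the Tset-end is switched before the Sset-end, so every intermediate set is a cover
edge-ranked : ∀ {k} {u v : WV k} → WE u v → Ranked u v ⊎ Ranked v u
edge-ranked {u = u} {v} (seq-left up i zero s)    = inj₁ (rank-<-column u v refl (s≤s z≤n) , _ , _)
edge-ranked {u = u} {v} (seq-left up i (suc j) s) = inj₁ (rank-<-slot u v refl refl (Fin.toℕ<n s) , _ , _)
edge-ranked {u = u} {v} (seq-left low i j s)      = inj₂ (rank-<-row v u ≤-refl , _ , _)
edge-ranked {u = u} {v} (seq-right up i j (suc j′) s (inj₁ j′≡j+1)) =
  inj₁ (rank-<-column u v refl (≤-reflexive (sym j′≡j+1)) , _ , _)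
edge-ranked {u = u} {v} (seq-right up i j zero s (inj₂ (_ , j+1≡k))) =
  inj₁ (rank-<-column u v refl (≤-reflexive j+1≡k) , _ , _)
edge-ranked {u = u} {v} (seq-right low i j j′ s (inj₁ j′≡j+1)) =
  inj₂ (rank-<-slot v u j′≡j+1 refl (m≤m+n 4 (toℕ s)) , _ , _)
edge-ranked {u = u} {v} (seq-right low i j j′ s (inj₂ (j′≡0 , _))) =
  inj₂ (rank-<-row v u (subst (_< suc (toℕ j)) (sym j′≡0) (s≤s z≤n)) , _ , _)
edge-ranked {k} {u} {v} (cross i j s t)         = inj₂ (rank-<-slot v u refl refl (sequin<4+ t (toℕ s)) , _ , _)

module _ {n : ℕ} where

  private
    k = suc n

  decode : ℕ → ℕ → ℕ → WV k
  decode r c 0 = wv up  (pred r mod k) (c mod k) s₀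
  decode r c 1 = wv up  (pred r mod k) (c mod k) s₁
  decode r c 2 = wv up  (pred r mod k) (c mod k) bead
  decode r c 3 = wv low (c mod k) (r mod k) bead
  decode r c 4 = wv low (c mod k) (pred r mod k) s₀
  decode r c _ = wv low (c mod k) (pred r mod k) s₁

  toℕ-mod : ∀ (i : Fin k) → toℕ i mod k ≡ i
  toℕ-mod i = Fin.toℕ-injective (trans (Fin.toℕ-fromℕ< _) (m<n⇒m%n≡m (Fin.toℕ<n i)))

  beadColumn-mod : ∀ (j : Fin k) → beadColumn j mod k ≡ j
  beadColumn-mod zero    = Fin.toℕ-injective (trans (Fin.toℕ-fromℕ< _) (n%n≡0 k))
  beadColumn-mod (suc j) = toℕ-mod (suc j)

  decode-position : ∀ v → decode (row v) (column v) (slot v) ≡ v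
  decode-position (wv up  i j (sequin zero))       = cong₂ (λ i j → wv up i j s₀) (toℕ-mod i) (toℕ-mod j)
  decode-position (wv up  i j (sequin (suc zero))) = cong₂ (λ i j → wv up i j s₁) (toℕ-mod i) (toℕ-mod j)
  decode-position (wv up  i j bead)                = cong₂ (λ i j → wv up i j bead) (toℕ-mod i) (beadColumn-mod j)
  decode-position (wv low i j bead)                = cong₂ (λ i j → wv low i j bead) (toℕ-mod i) (toℕ-mod j)
  decode-position (wv low i j (sequin zero))       = cong₂ (λ i j → wv low i j s₀) (toℕ-mod i) (toℕ-mod j)
  decode-position (wv low i j (sequin (suc zero))) = cong₂ (λ i j → wv low i j s₁) (toℕ-mod i) (toℕ-mod j)

position-injective : ∀ {k} {u v : WV k} → row u ≡ row v → column u ≡ column v → slot u ≡ slot v → u ≡ v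
position-injective {zero}  {wv _ () _ _}
position-injective {suc n} {u} {v} r≡r′ c≡c′ s≡s′ = begin
  u                                   ≡⟨ decode-position u ⟨
  decode (row u) (column u) (slot u)  ≡⟨ cong₂ (λ r c → decode r c (slot u)) r≡r′ c≡c′ ⟩
  decode (row v) (column v) (slot u)  ≡⟨ cong (decode (row v) (column v)) s≡s′ ⟩
  decode (row v) (column v) (slot v)  ≡⟨ decode-position v ⟩
  v                                   ∎
  where open ≡-Reasoning

rank-injective : ∀ {k} {u v : WV k} → rank u ≡ rank v → u ≡ v
rank-injective {u = u} {v} ru≡rv
  with then-eq₃ (cmp (row u) (row v)) (cmp (column u) (column v)) (cmp (slot u) (slot v))
                (trans (sym (cmp-rank u (column< v) (slot<6 v))) (trans (cong (cmp (rank u)) (sym ru≡rv)) (cmp-refl (rank u))))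
... | r , c , s = position-injective (cmp-eq⇒≡ r) (cmp-eq⇒≡ c) (cmp-eq⇒≡ s)

Sset≢Tset : ∀ {k} (v : WV k) → Sset v ≢ Tset v
Sset≢Tset (wv up  _ _ bead)       ()
Sset≢Tset (wv up  _ _ (sequin _)) ()
Sset≢Tset (wv low _ _ bead)       ()
Sset≢Tset (wv low _ _ (sequin _)) ()

module Switching (k : ℕ) = Schedule (W k) searchWV allWV-complete Sset Tset Sset≢Tset rank rank-injective

before : Cmp → Cmp → ℕ → ℕ → Bool
before oR oJ s σ = isLT ((oR then oJ) then cmp s σ)

-- weight of cell (i , j) at time code k R J σ, given o₁ = cmp (1 + i) R, o₀ = cmp i R,
-- oc = cmp j J and ob = cmp (beadColumn j) J
cellWeightAt : Cmp → Cmp → Cmp → Cmp → ℕ → ℕ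
cellWeightAt o₁ o₀ oc ob σ =
    (𝟙 (if before o₁ ob 2 σ then false else true)
     + (𝟙 (if before o₁ oc 0 σ then true else false) + 𝟙 (if before o₁ oc 1 σ then true else false)))
  + (𝟙 (if before o₀ oc 3 σ then true else false)
     + (𝟙 (if before o₁ oc 4 σ then false else true) + 𝟙 (if before o₁ oc 5 σ then false else true)))

module _ {k : ℕ} where

  open Switching k

  at-cover : ∀ t → IsVertexCover (W k) (at t)
  at-cover t u v (inj₁ e) = covered (edge-ranked e)
    where
    covered : Ranked u v ⊎ Ranked v u → T (at t u) ⊎ T (at t v)
    covered (inj₁ (ru<rv , Tu , Sv)) = at-covers t ru<rv Tu Sv
    covered (inj₂ (rv<ru , Tv , Su)) = swap (at-covers t rv<ru Tv Su)
  at-cover t u v (inj₂ e) = swap (at-cover t v u (inj₁ e))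

  cellWeight-at : ∀ {R J σ} → J < suc k → σ < 6 → ∀ i j →
                  cellWeight (at (code k R J σ)) i j ≡
                  cellWeightAt (cmp (suc (toℕ i)) R) (cmp (toℕ i) R) (cmp (toℕ j) J) (cmp (beadColumn j) J) σ
  cellWeight-at {R} {J} {σ} J<M σ<6 i j =
    cellWeight-bits {X = at (code k R J σ)} {i} {j} (bit (wv up i j bead)) (bit (wv up i j s₀)) (bit (wv up i j s₁))
                    (bit (wv low j i bead)) (bit (wv low j i s₀)) (bit (wv low j i s₁))
    where
    bit : ∀ v → at (code k R J σ) v ≡
                (if before (cmp (row v) R) (cmp (column v) J) (slot v) σ then Tset v else Sset v)
    bit v = cong (if_then Tset v else Sset v)
                 (trans (sym (isLT-cmp (rank v) (code k R J σ))) (cong isLT (cmp-rank v J<M σ<6)))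

-- only the cells of rows R - 1 and R can have weight above 3
upperExcess : Cmp → Cmp → ℕ → ℕ
upperExcess oc ob σ = cellWeightAt eq lt oc ob σ ∸ 3

lowerExcess : Cmp → ℕ → ℕ
lowerExcess oc σ = cellWeightAt gt eq oc oc σ ∸ 3

data RowCase : Cmp → Cmp → Set where
  i+1<R : RowCase lt lt
  i+1≡R : RowCase eq lt
  i≡R   : RowCase gt eq
  R<i   : RowCase gt gt

rowCase : ∀ i R → RowCase (cmp (suc i) R) (cmp i R)
rowCase zero    zero          = i≡R
rowCase zero    (suc zero)    = i+1≡R
rowCase zero    (suc (suc R)) = i+1<R
rowCase (suc i) zero          = R<i
rowCase (suc i) (suc R)       = rowCase i R

cellWeightAt-bound : ∀ {o₁ o₀} → RowCase o₁ o₀ → ∀ oc ob σ →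
               cellWeightAt o₁ o₀ oc ob σ ≤
               3 + ((if isEQ o₁ then upperExcess oc ob σ else 0) + (if isEQ o₀ then lowerExcess oc σ else 0))
cellWeightAt-bound i+1<R oc ob σ = ≤-refl
cellWeightAt-bound i+1≡R oc ob σ =
  subst (λ n → cellWeightAt eq lt oc ob σ ≤ 3 + n) (sym (+-identityʳ _)) (m≤n+m∸n (cellWeightAt eq lt oc ob σ) 3)
cellWeightAt-bound i≡R   oc ob σ = m≤n+m∸n (cellWeightAt gt eq oc ob σ) 3
cellWeightAt-bound R<i   oc ob σ = ≤-refl

data ColumnCase : Cmp → Cmp → Set where
  J<k : ∀ oc → ColumnCase oc gt
  J≡k : ColumnCase lt eq

columnCase : ∀ {k j J} → j < k → J < suc k → ColumnCase (cmp j J) (cmp k J)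
columnCase {k} {j} {J} j<k J<k+1 with m≤n⇒m<n∨m≡n (s≤s⁻¹ J<k+1)
... | inj₁ J<k′  rewrite cmp-> J<k′ = J<k (cmp j J)
... | inj₂ refl rewrite cmp-refl J | cmp-< j<k = J≡k

≤-on-slots : ∀ {f g : ℕ → ℕ} {p₀ : True (f 0 ≤? g 0)} {p₁ : True (f 1 ≤? g 1)} {p₂ : True (f 2 ≤? g 2)}
               {p₃ : True (f 3 ≤? g 3)} {p₄ : True (f 4 ≤? g 4)} {p₅ : True (f 5 ≤? g 5)} →
             ∀ σ → σ < 6 → f σ ≤ g σ
≤-on-slots {p₀ = p} 0 _ = toWitness p
≤-on-slots {p₁ = p} 1 _ = toWitness p
≤-on-slots {p₂ = p} 2 _ = toWitness p
≤-on-slots {p₃ = p} 3 _ = toWitness p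
≤-on-slots {p₄ = p} 4 _ = toWitness p
≤-on-slots {p₅ = p} 5 _ = toWitness p
≤-on-slots (suc (suc (suc (suc (suc (suc _)))))) (s≤s (s≤s (s≤s (s≤s (s≤s (s≤s ()))))))

-- checked by evaluation; z records whether j = 0, whose upper bead lies in column k
column-excess : ∀ {oc ok} → ColumnCase oc ok → ∀ z σ → σ < 6 →
                upperExcess oc (if z then ok else oc) σ + lowerExcess oc σ ≤
                1 + ((if z then 1 else 0) + (if isEQ oc then 2 else 0))
column-excess (J<k lt) false = ≤-on-slots
column-excess (J<k lt) true  = ≤-on-slots
column-excess (J<k eq) false = ≤-on-slots
column-excess (J<k eq) true  = ≤-on-slots
column-excess (J<k gt) false = ≤-on-slots
column-excess (J<k gt) true  = ≤-on-slots
column-excess J≡k      false = ≤-on-slots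
column-excess J≡k      true  = ≤-on-slots

isZero : ∀ {k} → Fin k → Bool
isZero zero    = true
isZero (suc _) = false

isZero-once : ∀ {k} (j j′ : Fin k) → T (isZero j) → T (isZero j′) → j ≡ j′
isZero-once zero zero _ _ = refl

beadColumn-cmp : ∀ {k} (j : Fin k) J → cmp (beadColumn j) J ≡ (if isZero j then cmp k J else cmp (toℕ j) J)
beadColumn-cmp zero    J = refl
beadColumn-cmp (suc j) J = refl

code-surjective : ∀ k t → ∃ λ R → ∃ λ J → ∃ λ σ → J < suc k × σ < 6 × t ≡ code k R J σ
code-surjective k t = q / suc k , q % suc k , t % 6 , m%n<n q (suc k) , m%n<n t 6 , t≡code
  where
  q = t / 6
  t≡code : t ≡ code k (q / suc k) (q % suc k) (t % 6)
  t≡code = begin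
    t                                        ≡⟨ m≡m%n+[m/n]*n t 6 ⟩
    t % 6 + q * 6                            ≡⟨ +-comm (t % 6) (q * 6) ⟩
    q * 6 + t % 6                            ≡⟨ cong (λ n → n * 6 + t % 6) (m≡m%n+[m/n]*n q (suc k)) ⟩
    (q % suc k + q / suc k * suc k) * 6 + t % 6 ≡⟨ cong (λ n → n * 6 + t % 6) (+-comm (q % suc k) _) ⟩
    code k (q / suc k) (q % suc k) (t % 6)   ∎
    where open ≡-Reasoning

upper-bound-arithmetic : ∀ k → k * (k * 3) + (k * 1 + (1 + 2)) ≡ 3 * (k * k) + (k + 3)
upper-bound-arithmetic = solve-∀

module _ {k : ℕ} where

  open Switching k

  column-bound : ∀ {R J σ} → J < suc k → σ < 6 → ∀ j →
                 ∑[ i < k ] cellWeight (at (code k R J σ)) i j ≤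
                 k * 3 + (1 + ((if isZero j then 1 else 0) + (if isEQ (cmp (toℕ j) J) then 2 else 0)))
  column-bound {R} {J} {σ} J<M σ<6 j = begin
    ∑[ i < k ] cellWeight (at (code k R J σ)) i j
      ≡⟨ sum-cong-≗ (λ i → cellWeight-at {k} {R} J<M σ<6 i j) ⟩
    ∑[ i < k ] cellWeightAt (o₁ i) (o₀ i) oc ob σ
      ≤⟨ ∑-mono-≤ {k} (λ i → cellWeightAt-bound (rowCase (toℕ i) R) oc ob σ) ⟩
    ∑[ i < k ] (3 + ((if isEQ (o₁ i) then U else 0) + (if isEQ (o₀ i) then L else 0)))
      ≡⟨ trans (∑-distrib-+ {k} (λ _ → 3) _) (cong₂ _+_ (∑-const k 3) (∑-distrib-+ {k} _ _)) ⟩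
    k * 3 + (∑[ i < k ] (if isEQ (o₁ i) then U else 0) + ∑[ i < k ] (if isEQ (o₀ i) then L else 0))
      ≤⟨ +-monoʳ-≤ (k * 3) (+-mono-≤ (∑-at-most-once {k} (isEQ ∘ o₁) U once₁)
                                     (∑-at-most-once {k} (isEQ ∘ o₀) L once₀)) ⟩
    k * 3 + (U + L)
      ≤⟨ +-monoʳ-≤ (k * 3) (subst (λ o → upperExcess oc o σ + L ≤ extra) (sym (beadColumn-cmp j J))
                                  (column-excess (columnCase (Fin.toℕ<n j) J<M) (isZero j) σ σ<6)) ⟩
    k * 3 + extra ∎
    where
    open ≤-Reasoning
    o₁ o₀ : Fin k → Cmp
    o₁ i = cmp (suc (toℕ i)) R
    o₀ i = cmp (toℕ i) R
    oc = cmp (toℕ j) J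
    ob = cmp (beadColumn j) J
    U = upperExcess oc ob σ
    L = lowerExcess oc σ
    extra = 1 + ((if isZero j then 1 else 0) + (if isEQ oc then 2 else 0))
    once₁ : ∀ i i′ → T (isEQ (o₁ i)) → T (isEQ (o₁ i′)) → i ≡ i′
    once₁ i i′ e e′ =
      Fin.toℕ-injective (suc-injective (trans (isEQ-cmp⇒≡ {n = R} e) (sym (isEQ-cmp⇒≡ {n = R} e′))))
    once₀ : ∀ i i′ → T (isEQ (o₀ i)) → T (isEQ (o₀ i′)) → i ≡ i′
    once₀ i i′ e e′ = Fin.toℕ-injective (trans (isEQ-cmp⇒≡ {n = R} e) (sym (isEQ-cmp⇒≡ {n = R} e′)))

  size-at : ∀ t → size (W k) (at t) ≤ 3 * (k * k) + (k + 3)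
  size-at t with code-surjective k t
  ... | R , J , σ , J<M , σ<6 , refl = begin
    size (W k) (at (code k R J σ))
      ≡⟨ trans (size-cells (at (code k R J σ))) (∑-comm (cellWeight (at (code k R J σ)))) ⟩
    ∑[ j < k ] ∑[ i < k ] cellWeight (at (code k R J σ)) i j
      ≤⟨ ∑-mono-≤ {k} (column-bound {R} J<M σ<6) ⟩
    ∑[ j < k ] (k * 3 + (1 + (z j + e j)))
      ≡⟨ trans (∑-distrib-+ {k} (λ _ → k * 3) _) (cong₂ _+_ (∑-const k (k * 3))
               (trans (∑-distrib-+ {k} (λ _ → 1) _) (cong₂ _+_ (∑-const k 1) (∑-distrib-+ {k} z e)))) ⟩
    k * (k * 3) + (k * 1 + (∑[ j < k ] z j + ∑[ j < k ] e j))
      ≤⟨ +-monoʳ-≤ (k * (k * 3)) (+-monoʳ-≤ (k * 1) (+-mono-≤ (∑-at-most-once {k} isZero 1 isZero-once)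
                                                               (∑-at-most-once {k} (isEQ ∘ oc) 2 J-once))) ⟩
    k * (k * 3) + (k * 1 + (1 + 2))
      ≡⟨ upper-bound-arithmetic k ⟩
    3 * (k * k) + (k + 3) ∎
    where
    open ≤-Reasoning
    oc : Fin k → Cmp
    oc j = cmp (toℕ j) J
    z e : Fin k → ℕ
    z j = if isZero j then 1 else 0
    e j = if isEQ (oc j) then 2 else 0
    J-once : ∀ j j′ → T (isEQ (oc j)) → T (isEQ (oc j′)) → j ≡ j′
    J-once j j′ e e′ = Fin.toℕ-injective (trans (isEQ-cmp⇒≡ {n = J} e) (sym (isEQ-cmp⇒≡ {n = J} e′)))

-- The threshold

module _ {k : ℕ} where

  open Switching k
  open ReconfDecision (W k) _≟ᵛ_ searchWV isVertexCoverW?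

  Feasible : ℕ → Set
  Feasible f = Reconf (W k) (3 * (k * k) + f) (6 * (k * k)) Sset Tset

  feasible? : ∀ f → Dec (Feasible f)
  feasible? f = reconf? _ _ Sset Tset

  all-switched : at (code k (suc k) 0 0) ≗ Tset
  all-switched v = cong (if_then Tset v else Sset v)
    (trans (sym (isLT-cmp (rank v) (code k (suc k) 0 0)))
           (cong isLT (cmp-< (radix-< 0 (radix-< 0 (s≤s (row≤ v)) (column< v)) (slot<6 v)))))

  valid-instance : ∀ f → ValidInstance (W k) Sset Tset (3 * (k * k) + f)
  valid-instance f = at-cover {k} 0 , ≤-trans (≤-reflexive (size-uniform {k} Sset 3 λ _ _ → refl)) (m≤m+n _ f) ,
            IsVertexCover-cong {G = W k} all-switched (at-cover {k} (code k (suc k) 0 0)) ,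
            ≤-trans (≤-reflexive (size-uniform {k} Tset 3 λ _ _ → refl)) (m≤m+n _ f)

  feasible-k+3 : Feasible (k + 3)
  feasible-k+3 =
    Reconf-weaken (≤-reflexive (size-uniform {k} (λ _ → true) 6 λ _ _ → refl))
      (Reconf-congʳ (λ v → trans (cong (λ t → at t v) (+-identityʳ end)) (all-switched v))
                    (schedule (at-cover {k}) (size-at {k}) end 0))
    where end = code k (suc k) 0 0

lower-bound-arithmetic : ∀ n → suc (suc (3 * ((2 + n) * (2 + n)) + n)) ≡ (2 + n) * suc ((2 + n) * 3)
lower-bound-arithmetic = solve-∀

infeasible-k∸2 : ∀ n → ¬ Feasible {2 + n} n
infeasible-k∸2 n = never-completes (≤-reflexive (lower-bound-arithmetic n)) zero λ { j (() , _) }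

2+n+3≡5+n : ∀ n → 2 + n + 3 ≡ 5 + n
2+n+3≡5+n n = cong (λ m → suc (suc m)) (+-comm n 3)

lemma8 : (k : ℕ) → 4 ≤ k →
    Σ ℕ λ f → (k ∸ 2 ≤ f) × (f ≤ k + 3) ×
      YesInstance (W k) Sset Tset (3 * (k * k) + f) (6 * (k * k)) ×
      NoInstance (W k) Sset Tset (3 * (k * k) + f ∸ 1) (6 * (k * k))
-- only k ≥ 2 is used
lemma8 (suc zero)       (s≤s ())
lemma8 k@(suc (suc n)) _ =
  let m , n≤m , m<5+n , ¬Pm , Pm+1 =
        threshold (feasible? {k}) 5 (infeasible-k∸2 n) (subst (Feasible {k}) (2+n+3≡5+n n) feasible-k+3)
  in suc m , m≤n⇒m≤1+n n≤m , subst (suc m ≤_) (sym (2+n+3≡5+n n)) m<5+n , (valid-instance (suc m) , Pm+1) ,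
     subst (λ b → NoInstance (W k) Sset Tset b (6 * (k * k))) (sym (cong (_∸ 1) (+-suc (3 * (k * k)) m)))
           (valid-instance m , ¬Pm)
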